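{- Let $A$ be a finite set of atoms and $P$ a propositional Horn theory over $A$. Then $P$ is idempotent, i.e. $P\circ P=P$, if and only if $$proper(P)\circ facts(P)\subseteq facts(P)\quad\text{and}\quad proper(P)=proper(proper(P)\circ P).$$
   Context: A theory over $A$ is a finite set of rules $a_0\leftarrow a_1,\ldots,a_k$ ($k\ge0$, $a_i\in A$), with $head(r)=\{a_0\}$, $body(r)=\{a_1,\ldots,a_k\}$, size $k$; $head(S),body(S)$ are unions over a set $S$ of rules. A fact is a rule with empty body, a proper rule is a rule that is not a fact; $facts(P)$ and $proper(P)$ denote the sets of facts and proper rules of $P$. Write $S\subseteq_r R$ if $S\subseteq R$ has as many elements as the size of $r$. Composition: $P\circ R=\{head(r)\leftarrow body(S)\mid r\in P,\ S\subseteq_r R,\ head(S)=body(r)\}$. -}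

module Defs where

open import Level using (0ℓ)
open import Data.Nat using (ℕ)
open import Data.Fin using (Fin)
open import Data.Fin.Subset using (Subset; ⊥; ∣_∣; ⋃; ⁅_⁆)
open import Data.List using (List; map; length)
open import Data.List.Relation.Unary.All using (All)
open import Data.List.Relation.Unary.Unique.Propositional using (Unique)
open import Data.Product using (Σ; _×_)
open import Relation.Binary.PropositionalEquality using (_≡_)
open import Relation.Nullary using (¬_)
open import Relation.Unary using (Pred)

-- Atoms: the finite set A is modelled as Fin n.
-- A rule  a₀ ← a₁,…,aₖ  has a head atom and a body, which is a set of atoms.
record Rule (n : ℕ) : Set where
  constructor _←_
  field
    hd : Fin n
    bd : Subset n
open Rule public

size : ∀ {n} → Rule n → ℕ
size r = ∣ bd r ∣

-- A theory over A: a set of rules (automatically finite since Rule n is finite).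
Theory : ℕ → Set₁
Theory n = Pred (Rule n) 0ℓ

heads : ∀ {n} → List (Rule n) → Subset n
heads S = ⋃ (map (λ r → ⁅ hd r ⁆) S)

bodies : ∀ {n} → List (Rule n) → Subset n
bodies S = ⋃ (map bd S)

facts : ∀ {n} → Theory n → Theory n
facts P r = P r × bd r ≡ ⊥

proper : ∀ {n} → Theory n → Theory n
proper P r = P r × ¬ (bd r ≡ ⊥)

-- S ⊆_r R : S is a set (duplicate-free list) of rules of R with exactly size(r) elements
_⊆[_]_ : ∀ {n} → List (Rule n) → Rule n → Theory n → Set
S ⊆[ r ] R = Unique S × All R S × length S ≡ size r

_∘ᵀ_ : ∀ {n} → Theory n → Theory n → Theory n
(P ∘ᵀ R) r′ = Σ (Rule _) λ r → P r × Σ (List (Rule _)) λ S →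
  S ⊆[ r ] R × heads S ≡ bd r × r′ ≡ (hd r ← bodies S)

-- A fact composes only with the empty set of rules and so reappears unchanged
-- in P ∘ R; hence P ∘ P = facts(P) ∪ proper(P) ∘ P. A composite of a proper
-- rule is a fact exactly when every rule it used is a fact, so proper(P) ∘ P
-- splits into the facts proper(P) ∘ facts(P) and the proper rules
-- proper(proper(P) ∘ P). Comparing the two sides of P ∘ P = P on facts and on
-- proper rules gives the two conditions.
module Submission where

open import Defs
open import Data.Nat using (ℕ)
open import Data.Bool.Properties using () renaming (_≟_ to _≟ᵇ_)
open import Data.Vec.Properties using (≡-dec)
open import Data.Fin.Subset using (Subset; ⊥; _∪_; ∣_∣) renaming (_⊆_ to _⊆ₛ_)
open import Data.Fin.Subset.Properties
  using (⊆-antisym; ⊥⊆; p⊆p∪q; q⊆p∪q; ∪-identityˡ; ∣⊥∣≡0)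
open import Data.List using (List; []; _∷_; length)
open import Data.List.Relation.Unary.All as All using (All; []; _∷_)
import Data.List.Relation.Unary.AllPairs as AllPairs
open import Data.Product using (_×_; _,_; proj₁; proj₂)
open import Data.Sum using (_⊎_; inj₁; inj₂; [_,_]′)
open import Function using (id)
open import Function.Bundles using (_⇔_; mk⇔)
open import Relation.Binary.PropositionalEquality using (_≡_; refl; sym; trans; cong; cong₂; subst)
open import Relation.Nullary using (yes; no; contradiction)
open import Relation.Unary using (_⊆_; _≐_; Decidable)

∪-≡-⊥⁻ : ∀ {n} (p q : Subset n) → p ∪ q ≡ ⊥ → p ≡ ⊥ × q ≡ ⊥
∪-≡-⊥⁻ p q eq =
  ⊆-antisym (subst (p ⊆ₛ_) eq (p⊆p∪q q)) ⊥⊆ ,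
  ⊆-antisym (subst (q ⊆ₛ_) eq (q⊆p∪q p q)) ⊥⊆

IsFact : ∀ {n} → Rule n → Set
IsFact r = bd r ≡ ⊥

isFact? : ∀ {n} → Decidable (IsFact {n})
isFact? r = ≡-dec _≟ᵇ_ (bd r) ⊥

facts-or-proper : ∀ {n} (P : Theory n) {r} → P r → facts P r ⊎ proper P r
facts-or-proper P {r} p with isFact? r
... | yes e = inj₁ (p , e)
... | no ¬e = inj₂ (p , ¬e)

bodies-≡-⊥⁺ : ∀ {n} {S : List (Rule n)} → All IsFact S → bodies S ≡ ⊥
bodies-≡-⊥⁺ []       = refl
bodies-≡-⊥⁺ (e ∷ es) = trans (cong₂ _∪_ e (bodies-≡-⊥⁺ es)) (∪-identityˡ ⊥)

bodies-≡-⊥⁻ : ∀ {n} (S : List (Rule n)) → bodies S ≡ ⊥ → All IsFact S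
bodies-≡-⊥⁻ []      _  = []
bodies-≡-⊥⁻ (s ∷ S) eq with ∪-≡-⊥⁻ (bd s) (bodies S) eq
... | e , es = e ∷ bodies-≡-⊥⁻ S es

size-fact : ∀ {n} (r : Rule n) → IsFact r → size r ≡ 0
size-fact {n} _ e = trans (cong ∣_∣ e) (∣⊥∣≡0 n)

length≡0⇒≡[] : ∀ {A : Set} (xs : List A) → length xs ≡ 0 → xs ≡ []
length≡0⇒≡[] [] _ = refl

∘-mono : ∀ {n} {P P′ R R′ : Theory n} → P ⊆ P′ → R ⊆ R′ → (P ∘ᵀ R) ⊆ (P′ ∘ᵀ R′)
∘-mono P⊆P′ R⊆R′ (r , p , S , (u , rs , len) , hs , eq) =
  r , P⊆P′ p , S , (u , All.map R⊆R′ rs , len) , hs , eq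

facts⊆∘ : ∀ {n} {P R : Theory n} → facts P ⊆ (P ∘ᵀ R)
facts⊆∘ {x = r} (p , e) =
  r , p , [] , (AllPairs.[] , [] , sym (size-fact r e)) , sym e , cong (hd r ←_) e

∘⇒facts⊎proper∘ : ∀ {n} {P R : Theory n} {r′} → (P ∘ᵀ R) r′ → facts P r′ ⊎ (proper P ∘ᵀ R) r′
∘⇒facts⊎proper∘ {P = P} (r , p , S , S⊆R@(_ , _ , len) , hs , refl) with isFact? r
... | no ¬e = inj₂ (r , (p , ¬e) , S , S⊆R , hs , refl)
... | yes e with length≡0⇒≡[] S (trans len (size-fact r e))
...   | refl = inj₁ (subst (λ b → P (hd r ← b)) e p , refl)

∘-facts-isFact : ∀ {n} {P R : Theory n} {r′} → (P ∘ᵀ facts R) r′ → IsFact r′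
∘-facts-isFact {R = R} (_ , _ , _ , (_ , rs , _) , _ , refl) =
  bodies-≡-⊥⁺ (All.map {P = facts R} proj₂ rs)

isFact-∘⇒∘-facts : ∀ {n} {P R : Theory n} {r′} → (P ∘ᵀ R) r′ → IsFact r′ → (P ∘ᵀ facts R) r′
isFact-∘⇒∘-facts (r , p , S , (u , rs , len) , hs , refl) e =
  r , p , S , (u , All.zipWith id (rs , bodies-≡-⊥⁻ S e) , len) , hs , refl

proposition3p7 : (n : ℕ) (P : Defs.Theory n) →
    ((P ∘ᵀ P) ≐ P) ⇔ (((proper P ∘ᵀ facts P) ⊆ facts P) × (proper P ≐ proper (proper P ∘ᵀ P)))
proposition3p7 n P = mk⇔ idempotent⇒ ⇒idempotent
  where
  idempotent⇒ : (P ∘ᵀ P) ≐ P → ((proper P ∘ᵀ facts P) ⊆ facts P) × (proper P ≐ proper (proper P ∘ᵀ P))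
  idempotent⇒ (P∘P⊆P , P⊆P∘P) =
    (λ c → P∘P⊆P (∘-mono proj₁ proj₁ c) , ∘-facts-isFact c) ,
    (λ (p , ¬e) → [ (λ (_ , e) → contradiction e ¬e) , (_, ¬e) ]′ (∘⇒facts⊎proper∘ (P⊆P∘P p))) ,
    (λ (c , ¬e) → P∘P⊆P (∘-mono proj₁ id c) , ¬e)

  ⇒idempotent : ((proper P ∘ᵀ facts P) ⊆ facts P) × (proper P ≐ proper (proper P ∘ᵀ P)) → (P ∘ᵀ P) ≐ P
  ⇒idempotent (closed , proper⊆ , ⊆proper) =
    (λ c → [ proj₁ , proper∘P⊆P ]′ (∘⇒facts⊎proper∘ c)) ,
    (λ p → [ facts⊆∘ {R = P} , (λ q → ∘-mono proj₁ id (proj₁ (proper⊆ q))) ]′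
             (facts-or-proper P p))
    where
    proper∘P⊆P : (proper P ∘ᵀ P) ⊆ P
    proper∘P⊆P {r′} c with isFact? r′
    ... | yes e = proj₁ (closed (isFact-∘⇒∘-facts c e))
    ... | no ¬e = proj₁ (⊆proper (c , ¬e))
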